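{- Let $l,a,b$ be positive integers and $p<q$ positive odd integers such that $q\ge 2l$, $a<b<2l-2$, $S^l_{a,b}(p)=S^l_{a,b}(q)$, and $U(a,b)\cap2\mathbb{Z}\cap[2l,3q-p]=\emptyset$. Then $U(a,b)\cap 2\mathbb{Z}\cap[2l,\infty)=\emptyset$.
   Context: For positive integers $a<b$, the Ulam sequence $U(a,b)$ is the increasing sequence whose first two terms are $a,b$ and in which each subsequent term is the smallest integer larger than the previous term that can be written as $u+v$ with $u<v$ earlier terms in exactly one way; we identify it with its set of terms, and $1_{U(a,b)}$ denotes its indicator function. For a positive integer $l$ and positive odd integer $k$, $S^l_{a,b}(k)$ is the finite sequence $\big(1_{U(a,b)}(k+2i)\big)_{i=0}^{l-2}$. -}

module Defs where

open import Data.Nat using (ℕ; zero; suc; _+_; _*_; _<ᵇ_; _≡ᵇ_; _∸_)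
open import Data.Bool using (Bool; true; false; if_then_else_; _∧_; _∨_)
open import Data.List using (List; []; _∷_; _++_; [_]; map; upTo; length; filterᵇ; cartesianProductWith)
open import Data.Bool.ListAction using (any)

reps : ℕ → List ℕ → ℕ
reps n L = length (filterᵇ (λ x → x)
             (cartesianProductWith (λ u v → (u <ᵇ v) ∧ ((u + v) ≡ᵇ n)) L L))

isTerm : ℕ → ℕ → ℕ → List ℕ → Bool
isTerm a b n L = (n ≡ᵇ a) ∨ (n ≡ᵇ b) ∨ ((b <ᵇ n) ∧ (reps n L ≡ᵇ 1))

ulamBelow : ℕ → ℕ → ℕ → List ℕ
ulamBelow a b zero = []
ulamBelow a b (suc n) =
  if isTerm a b n (ulamBelow a b n)
  then ulamBelow a b n ++ [ n ]
  else ulamBelow a b n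

indU : ℕ → ℕ → ℕ → Bool
indU a b n = any (λ m → m ≡ᵇ n) (ulamBelow a b (suc n))

S : ℕ → ℕ → ℕ → ℕ → List Bool
S l a b k = map (λ i → indU a b (k + 2 * i)) (upTo (l ∸ 1))

open import Relation.Binary.PropositionalEquality using (_≡_; refl)
private
  test : ulamBelow 1 2 19 ≡ 1 ∷ 2 ∷ 3 ∷ 4 ∷ 6 ∷ 8 ∷ 11 ∷ 13 ∷ 16 ∷ 18 ∷ []
  test = refl

module Submission where

-- For odd n such a representation
-- has exactly one even part (`odd-rule`).  In the setting of the theorem we
-- then argue by strong induction, as long as no even term ≥ 2l has appeared:
--  * `periodic`: for odd m ≥ p, m is a term iff m + d is.  Below p + 2l - 2
--    this is the window hypothesis; above it, the even parts of representations
--    of m are at most 2l - 2, so their odd complements are shifted by d;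
--  * `no-large-even-term`: an even n > 2q + d with a unique representation
--    u + v would have u, v odd, and moving d between u and v (by periodicity)
--    either yields an even term n - d or a second representation of n.

open import Defs
open import Data.Nat using (ℕ; zero; suc; _+_; _*_; _∸_; _≤_; _<_; _≡ᵇ_; _<ᵇ_; s≤s; z<s; _≤?_; _<?_)
open import Data.Nat.Properties
open import Data.Nat.Induction using (<-rec)
open import Data.Nat.Tactic.RingSolver using (solve-∀)
open import Data.Nat.Divisibility using (_∣_; _∣?_; divides; ∣m∣n⇒∣m+n; ∣m+n∣m⇒∣n)
open import Data.Bool using (Bool; true; false; T; T?; _∧_)
open import Data.Bool.Properties using (T-∧; T-≡; ¬-not)
open import Data.List using (List; []; _∷_; _++_; [_]; map; length; filter; filterᵇ; cartesianProductWith; cartesianProduct)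
open import Data.List.Properties using (map-++; map-∘; ∷-injective)
open import Data.List.Membership.Propositional using (_∈_)
open import Data.List.Membership.Propositional.Properties
  using (∈-++⁻; ∈-++⁺ˡ; ∈-++⁺ʳ; ∈-upTo⁺; ∈-filter⁺; ∈-filter⁻; ∈-cartesianProduct⁺; ∈-cartesianProduct⁻)
open import Data.List.Relation.Unary.Any as Any using (Any; here; there)
open import Data.List.Relation.Unary.Any.Properties using (any⇔)
open import Data.List.Relation.Unary.All using ([]; _∷_)
open import Data.List.Relation.Unary.AllPairs using ([]; _∷_)
open import Data.List.Relation.Unary.Unique.Propositional using (Unique)
open import Data.List.Relation.Unary.Unique.Propositional.Properties using (++⁺; filter⁺; cartesianProduct⁺)
open import Data.Product using (∃; ∃!; _×_; _,_; proj₁; proj₂; uncurry)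
open import Data.Sum using (_⊎_; inj₁; inj₂)
open import Data.Empty using (⊥; ⊥-elim)
open import Function using (_∘_; _⇔_; mk⇔; Equivalence)
open import Function.Properties.Equivalence using (⇔-setoid) renaming (trans to ⇔-trans)
open import Level using (0ℓ)
open import Relation.Nullary using (¬_; yes; no; contradiction)
open import Relation.Nullary.Decidable using (decidable-stable)
open import Relation.Unary using (Pred; Decidable)
open import Relation.Binary using (tri<; tri≈; tri>)
open import Relation.Binary.PropositionalEquality using (_≡_; _≢_; refl; sym; trans; cong; cong₂; subst; module ≡-Reasoning)
import Relation.Binary.Reasoning.Setoid as SetoidReasoning

open Equivalence using (to; from)

module ⇔-Reasoning = SetoidReasoning (⇔-setoid 0ℓ)

∃!-cong : {A : Set} {P Q : A → Set} → (∀ x → P x ⇔ Q x) → ∃! _≡_ P ⇔ ∃! _≡_ Q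
∃!-cong P⇔Q = mk⇔
  (λ (x , px , uniq) → x , to (P⇔Q x) px , λ {y} qy → uniq (from (P⇔Q y) qy))
  (λ (x , qx , uniq) → x , from (P⇔Q x) qx , λ {y} py → uniq (to (P⇔Q y) py))

∃!-transport : {A B : Set} {P : A → Set} {Q : B → Set} (f : A → B) →
  (∀ {x} → P x → Q (f x)) → (∀ {y} → Q y → ∃ λ x → P x × f x ≡ y) →
  (∀ {x x'} → P x → P x' → f x ≡ f x' → x ≡ x') → ∃! _≡_ P ⇔ ∃! _≡_ Q
∃!-transport f into onto injective = mk⇔
  (λ (x , px , onlyX) → f x , into px ,
     λ qy → let (x' , px' , fx'≡y) = onto qy in trans (cong f (onlyX px')) fx'≡y)
  (λ (y , qy , onlyY) → let (x , px , fx≡y) = onto qy in x , px ,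
     λ px' → injective px px' (trans fx≡y (onlyY (into px'))))

length≡1⇔∃! : {A : Set} {ys : List A} → Unique ys → length ys ≡ 1 ⇔ ∃! _≡_ (_∈ ys)
length≡1⇔∃! {ys = ys} uniq = mk⇔ (one ys) (single ys uniq)
  where
  one : ∀ ys → length ys ≡ 1 → ∃! _≡_ (_∈ ys)
  one (y ∷ []) _ = y , here refl , λ { (here y'≡y) → sym y'≡y }
  single : ∀ ys → Unique ys → ∃! _≡_ (_∈ ys) → length ys ≡ 1
  single (y ∷ []) _ _ = refl
  single (y ∷ y' ∷ _) ((y≢y' ∷ _) ∷ _) (z , _ , onlyZ) =
    ⊥-elim (y≢y' (trans (sym (onlyZ (here refl))) (onlyZ (there (here refl)))))

count≡1⇔∃! : {A : Set} {P : Pred A 0ℓ} (P? : Decidable P) {xs : List A} → Unique xs →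
             length (filter P? xs) ≡ 1 ⇔ ∃! _≡_ (λ x → x ∈ xs × P x)
count≡1⇔∃! P? uniq = ⇔-trans (length≡1⇔∃! (filter⁺ P? uniq))
                             (∃!-cong λ _ → mk⇔ (∈-filter⁻ P?) (uncurry (∈-filter⁺ P?)))

length-filter-map : {A : Set} (h : A → Bool) (zs : List A) →
                    length (filterᵇ (λ x → x) (map h zs)) ≡ length (filterᵇ h zs)
length-filter-map h [] = refl
length-filter-map h (z ∷ zs) with h z
... | true = cong suc (length-filter-map h zs)
... | false = length-filter-map h zs

cartesianProductWith-map : {A B C : Set} (f : A → B → C) (xs : List A) (ys : List B) →
                           cartesianProductWith f xs ys ≡ map (uncurry f) (cartesianProduct xs ys)
cartesianProductWith-map f [] ys = refl
cartesianProductWith-map f (x ∷ xs) ys = begin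
  map (f x) ys ++ cartesianProductWith f xs ys
    ≡⟨ cong₂ _++_ (map-∘ ys) (cartesianProductWith-map f xs ys) ⟩
  map (uncurry f) (map (x ,_) ys) ++ map (uncurry f) (cartesianProduct xs ys)
    ≡⟨ map-++ (uncurry f) (map (x ,_) ys) _ ⟨
  map (uncurry f) (cartesianProduct (x ∷ xs) ys) ∎
  where open ≡-Reasoning

map-≡⇒pointwise : {A B : Set} {f g : A → B} {xs : List A} → map f xs ≡ map g xs →
                  ∀ {x} → x ∈ xs → f x ≡ g x
map-≡⇒pointwise {xs = _ ∷ _} eq (here refl) = proj₁ (∷-injective eq)
map-≡⇒pointwise {xs = _ ∷ _} eq (there x∈) = map-≡⇒pointwise (proj₂ (∷-injective eq)) x∈

Even Odd : ℕ → Set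
Even n = 2 ∣ n
Odd n = ¬ Even n

even+even : ∀ {x y} → Even x → Even y → Even (x + y)
even+even = ∣m∣n⇒∣m+n

even+odd : ∀ {x y} → Even x → Odd y → Odd (x + y)
even+odd ex oy exy = oy (∣m+n∣m⇒∣n exy ex)

odd+even : ∀ {x y} → Odd x → Even y → Odd (x + y)
odd+even {x} {y} ox ey = subst Odd (+-comm y x) (even+odd ey ox)

even-or-suc-even : ∀ n → Even n ⊎ Even (suc n)
even-or-suc-even zero = inj₁ (divides 0 refl)
even-or-suc-even (suc n) with even-or-suc-even n
... | inj₁ en = inj₂ (even+even {2} (divides 1 refl) en)
... | inj₂ esn = inj₁ esn

odd⇒suc-even : ∀ {n} → Odd n → Even (suc n)
odd⇒suc-even {n} on with even-or-suc-even n
... | inj₁ en = ⊥-elim (on en)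
... | inj₂ esn = esn

odd+odd : ∀ {x y} → Odd x → Odd y → Even (x + y)
odd+odd {x} {y} ox oy = ∣m+n∣m⇒∣n (subst Even (cong suc (+-suc x y))
                                            (even+even (odd⇒suc-even ox) (odd⇒suc-even oy)))
                                   (divides 1 refl)

odd⇒0< : ∀ {n} → Odd n → 0 < n
odd⇒0< {zero} odd-0 = ⊥-elim (odd-0 (divides 0 refl))
odd⇒0< {suc n} _ = z<s

odd-difference : ∀ {x k} → Odd x → Odd (x + k) → Even k
odd-difference ox oxk = ∣m+n∣m⇒∣n (odd⇒suc-even oxk) (odd⇒suc-even ox)

even<even⇒+2≤ : ∀ {x y} → Even x → Even y → x < y → x + 2 ≤ y
even<even⇒+2≤ {x} {y} (divides i refl) (divides j refl) x<y =
  subst (_≤ j * 2) (+-comm 2 (i * 2)) (*-monoˡ-≤ 2 (*-cancelʳ-< 2 i j x<y))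

same-sum-first : ∀ {u v u' v'} → u + v ≡ u' + v' → u ≡ u' → (u , v) ≡ (u' , v')
same-sum-first {u} {v} {v' = v'} sum refl = cong (u ,_) (+-cancelˡ-≡ u v v' sum)

same-sum-second : ∀ {u v u' v'} → u + v ≡ u' + v' → v ≡ v' → (u , v) ≡ (u' , v')
same-sum-second {u} {v} {u'} sum refl = cong (_, v) (+-cancelʳ-≡ v u u' sum)

increasing-not-crossed : ∀ {u v u' v'} → u < v → u' < v' → u + v ≡ u' + v' → u ≢ v'
increasing-not-crossed {u} {v} {u'} u<v u'<v' sum refl =
  <-asym u<v (subst (_< u) (sym (+-cancelˡ-≡ u v u' (trans sum (+-comm u' u)))) u'<v')

top-above-half : ∀ {u v k x} → u < v → u + v ≡ k → x + x ≤ k → x < v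
top-above-half {u} {v} {k} {x} u<v refl 2x≤k with x <? v
... | yes x<v = x<v
... | no x≮v = ⊥-elim (<-irrefl refl (<-≤-trans (+-mono-<-≤ (<-≤-trans u<v v≤x) v≤x) 2x≤k))
  where
  v≤x : v ≤ x
  v≤x = ≮⇒≥ x≮v

below-by : ∀ {d x} → d ≤ x → ∃ λ w → w + d ≡ x
below-by {d} {x} d≤x = x ∸ d , m∸n+n≡m d≤x

double-pred : ∀ l → 2 * l ∸ 2 ≡ (l ∸ 1) * 2
double-pred zero = refl
double-pred (suc l) = trans (cong (_∸ 1) (+-suc l (l + 0))) (*-comm 2 l)

three-q∸p : ∀ p d → 3 * (p + d) ∸ p ≡ (p + d) + (p + d) + d
three-q∸p p d = trans (cong (_∸ p) (expand p d)) (m+n∸m≡n p _)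
  where
  expand : ∀ p d → 3 * (p + d) ≡ p + ((p + d) + (p + d) + d)
  expand = solve-∀

≢⇒≡ᵇ≡false : ∀ {m n} → m ≢ n → (m ≡ᵇ n) ≡ false
≢⇒≡ᵇ≡false {m} {n} m≢n with m ≡ᵇ n in eq
... | true = ⊥-elim (m≢n (≡ᵇ⇒≡ m n (subst T (sym eq) _)))
... | false = refl

module Ulam (a b : ℕ) where

  PassesTest : ℕ → Set
  PassesTest n = T (isTerm a b n (ulamBelow a b n))

  Term : ℕ → Set
  Term n = T (indU a b n)

  ∈-ulamBelow : ∀ {x} n → x ∈ ulamBelow a b n ⇔ (PassesTest x × x < n)
  ∈-ulamBelow {x} zero = mk⇔ (λ ()) (λ ())
  ∈-ulamBelow {x} (suc n) with isTerm a b n (ulamBelow a b n) in passes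
  ... | true = mk⇔ forward backward
    where
    forward : x ∈ ulamBelow a b n ++ [ n ] → PassesTest x × x < suc n
    forward x∈ with ∈-++⁻ (ulamBelow a b n) x∈
    ... | inj₁ x∈L = let (px , x<n) = to (∈-ulamBelow n) x∈L in px , m<n⇒m<1+n x<n
    ... | inj₂ (here refl) = subst T (sym passes) _ , ≤-refl
    backward : PassesTest x × x < suc n → x ∈ ulamBelow a b n ++ [ n ]
    backward (px , x<1+n) with m<1+n⇒m<n∨m≡n x<1+n
    ... | inj₁ x<n = ∈-++⁺ˡ (from (∈-ulamBelow n) (px , x<n))
    ... | inj₂ refl = ∈-++⁺ʳ (ulamBelow a b n) (here refl)
  ... | false = mk⇔ forward backward
    where
    forward : x ∈ ulamBelow a b n → PassesTest x × x < suc n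
    forward x∈L = let (px , x<n) = to (∈-ulamBelow n) x∈L in px , m<n⇒m<1+n x<n
    backward : PassesTest x × x < suc n → x ∈ ulamBelow a b n
    backward (px , x<1+n) with m<1+n⇒m<n∨m≡n x<1+n
    ... | inj₁ x<n = from (∈-ulamBelow n) (px , x<n)
    ... | inj₂ refl = ⊥-elim (subst T passes px)

  Term⇔PassesTest : ∀ n → Term n ⇔ PassesTest n
  Term⇔PassesTest n = begin
    Term n                                        ≈⟨ any⇔ ⟨
    Any (λ m → T (m ≡ᵇ n)) (ulamBelow a b (suc n)) ≈⟨ mk⇔ (Any.map (sym ∘ ≡ᵇ⇒≡ _ n))
                                                         (Any.map (λ eq → ≡⇒≡ᵇ _ n (sym eq))) ⟩
    n ∈ ulamBelow a b (suc n)                      ≈⟨ ∈-ulamBelow (suc n) ⟩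
    (PassesTest n × n < suc n)                     ≈⟨ mk⇔ proj₁ (_, ≤-refl) ⟩
    PassesTest n                                   ∎
    where open ⇔-Reasoning

  ∈-ulamBelow⇔Term : ∀ {x} n → x ∈ ulamBelow a b n ⇔ (Term x × x < n)
  ∈-ulamBelow⇔Term {x} n = ⇔-trans (∈-ulamBelow n)
    (mk⇔ (λ (px , x<n) → from (Term⇔PassesTest x) px , x<n)
         (λ (tx , x<n) → to (Term⇔PassesTest x) tx , x<n))

  unique-ulamBelow : ∀ n → Unique (ulamBelow a b n)
  unique-ulamBelow zero = []
  unique-ulamBelow (suc n) with isTerm a b n (ulamBelow a b n)
  ... | true = ++⁺ (unique-ulamBelow n) ([] ∷ [])
                   (λ { (n∈L , here refl) → <-irrefl refl (proj₂ (to (∈-ulamBelow n) n∈L)) })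
  ... | false = unique-ulamBelow n

  module Rule (0<a : 0 < a) (a<b : a < b) where

    term-pos : ∀ {n} → Term n → 0 < n
    term-pos {zero} t = ⊥-elim (subst T zero-fails (to (Term⇔PassesTest 0) t))
      where
      zero-fails : isTerm a b 0 (ulamBelow a b 0) ≡ false
      zero-fails rewrite ≢⇒≡ᵇ≡false (<⇒≢ 0<a) | ≢⇒≡ᵇ≡false (<⇒≢ (<-trans 0<a a<b)) = refl
    term-pos {suc n} _ = z<s

    IsRep : ℕ → ℕ × ℕ → Set
    IsRep n (u , v) = Term u × Term v × u < v × u + v ≡ n

    UniqueRep : ℕ → Set
    UniqueRep n = ∃! _≡_ (IsRep n)

    rep-parts< : ∀ {n u v} → IsRep n (u , v) → u < n × v < n
    rep-parts< (tu , tv , _ , refl) = m<m+n _ (term-pos tv) , m<n+m _ (term-pos tu)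

    sumsTo : ℕ → ℕ × ℕ → Bool
    sumsTo n = uncurry λ u v → (u <ᵇ v) ∧ (u + v ≡ᵇ n)

    reps≡count : ∀ n L → reps n L ≡ length (filterᵇ (sumsTo n) (cartesianProduct L L))
    reps≡count n L = trans (cong (length ∘ filterᵇ (λ x → x)) (cartesianProductWith-map _ L L))
                           (length-filter-map (sumsTo n) (cartesianProduct L L))

    counted⇔IsRep : ∀ n uv →
      (uv ∈ cartesianProduct (ulamBelow a b n) (ulamBelow a b n) × T (sumsTo n uv)) ⇔ IsRep n uv
    counted⇔IsRep n (u , v) = mk⇔ forward backward
      where
      Counted : Set
      Counted = (u , v) ∈ cartesianProduct (ulamBelow a b n) (ulamBelow a b n) × T (sumsTo n (u , v))
      forward : Counted → IsRep n (u , v)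
      forward (uv∈ , test) =
        let (u∈ , v∈) = ∈-cartesianProduct⁻ _ _ uv∈
            (u<v , sum) = to T-∧ test
        in proj₁ (to (∈-ulamBelow⇔Term n) u∈) , proj₁ (to (∈-ulamBelow⇔Term n) v∈) ,
           <ᵇ⇒< u v u<v , ≡ᵇ⇒≡ (u + v) n sum
      backward : IsRep n (u , v) → Counted
      backward rep@(tu , tv , u<v , sum) =
        let (u<n , v<n) = rep-parts< rep
        in ∈-cartesianProduct⁺ (from (∈-ulamBelow⇔Term n) (tu , u<n)) (from (∈-ulamBelow⇔Term n) (tv , v<n)) ,
           from T-∧ (<⇒<ᵇ u<v , ≡⇒≡ᵇ (u + v) n sum)

    passes⇔reps≡1 : ∀ {n} → b < n → PassesTest n ⇔ reps n (ulamBelow a b n) ≡ 1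
    passes⇔reps≡1 {n} b<n
      rewrite ≢⇒≡ᵇ≡false (>⇒≢ (<-trans a<b b<n)) | ≢⇒≡ᵇ≡false (>⇒≢ b<n) | to T-≡ (<⇒<ᵇ b<n)
      = mk⇔ (≡ᵇ⇒≡ _ 1) (≡⇒≡ᵇ _ 1)

    ulam-rule : ∀ {n} → b < n → Term n ⇔ UniqueRep n
    ulam-rule {n} b<n = begin
      Term n
        ≈⟨ Term⇔PassesTest n ⟩
      PassesTest n
        ≈⟨ passes⇔reps≡1 b<n ⟩
      reps n L ≡ 1
        ≈⟨ mk⇔ (trans (sym (reps≡count n L))) (trans (reps≡count n L)) ⟩
      length (filterᵇ (sumsTo n) (cartesianProduct L L)) ≡ 1
        ≈⟨ count≡1⇔∃! (T? ∘ sumsTo n) (cartesianProduct⁺ (unique-ulamBelow n) (unique-ulamBelow n)) ⟩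
      ∃! _≡_ (λ uv → uv ∈ cartesianProduct L L × T (sumsTo n uv))
        ≈⟨ ∃!-cong (counted⇔IsRep n) ⟩
      UniqueRep n ∎
      where
      open ⇔-Reasoning
      L : List ℕ
      L = ulamBelow a b n

    EvenSummand : ℕ → ℕ → Set
    EvenSummand n e = Even e × Term e × ∃ λ o → Term o × e + o ≡ n

    evenMember : ℕ × ℕ → ℕ
    evenMember (u , v) with 2 ∣? u
    ... | yes _ = u
    ... | no _ = v

    module _ {n} (odd-n : Odd n) where

      complement-odd : ∀ {e o} → Even e → e + o ≡ n → Odd o
      complement-odd ee sum eo = odd-n (subst Even sum (even+even ee eo))

      rep⇒evenSummand : ∀ {uv} → IsRep n uv → EvenSummand n (evenMember uv)
      rep⇒evenSummand {u , v} (tu , tv , _ , sum) with 2 ∣? u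
      ... | yes eu = eu , tu , v , tv , sum
      ... | no ou = ev , tv , u , tu , trans (+-comm v u) sum
        where
        ev : Even v
        ev = decidable-stable (2 ∣? v) (λ ov → odd-n (subst Even sum (odd+odd ou ov)))

      evenSummand⇒rep : ∀ {e} → EvenSummand n e → ∃ λ uv → IsRep n uv × evenMember uv ≡ e
      evenSummand⇒rep {e} (ee , te , o , t-o , sum) with <-cmp e o
      ... | tri< e<o _ _ = (e , o) , (te , t-o , e<o , sum) , picks-e
        where
        picks-e : evenMember (e , o) ≡ e
        picks-e with 2 ∣? e
        ... | yes _ = refl
        ... | no oe = ⊥-elim (oe ee)
      ... | tri≈ _ refl _ = ⊥-elim (complement-odd ee sum ee)
      ... | tri> _ _ o<e = (o , e) , (t-o , te , o<e , trans (+-comm o e) sum) , picks-e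
        where
        picks-e : evenMember (o , e) ≡ e
        picks-e with 2 ∣? o
        ... | yes eo = ⊥-elim (complement-odd ee sum eo)
        ... | no _ = refl

      evenMember-injective : ∀ {uv uv'} → IsRep n uv → IsRep n uv' →
                             evenMember uv ≡ evenMember uv' → uv ≡ uv'
      evenMember-injective {u , v} {u' , v'} (_ , _ , u<v , s) (_ , _ , u'<v' , s') eq
        with 2 ∣? u | 2 ∣? u'
      ... | yes _ | yes _ = same-sum-first (trans s (sym s')) eq
      ... | no _  | no _  = same-sum-second (trans s (sym s')) eq
      ... | yes _ | no _  = ⊥-elim (increasing-not-crossed u<v u'<v' (trans s (sym s')) eq)
      ... | no _  | yes _ = ⊥-elim (increasing-not-crossed u'<v' u<v (trans s' (sym s)) (sym eq))

      odd-rule : UniqueRep n ⇔ ∃! _≡_ (EvenSummand n)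
      odd-rule = ∃!-transport evenMember rep⇒evenSummand evenSummand⇒rep evenMember-injective

-- The setting of the theorem, with q = p + d.  The window hypothesis is the
-- equality of S^l_{a,b}(p) and S^l_{a,b}(q), read pointwise.
module Setting (a b l p d : ℕ) (0<a : 0 < a) (a<b : a < b) (b<2l-2 : b < 2 * l ∸ 2)
  (odd-p : Odd p) (odd-q : Odd (p + d)) (0<d : 0 < d)
  (window : ∀ i → i < l ∸ 1 → indU a b (p + 2 * i) ≡ indU a b (p + d + 2 * i))
  where

  open Ulam a b
  open Rule 0<a a<b

  even-d : Even d
  even-d = odd-difference odd-p odd-q

  LargeEvenFree : ℕ → Set
  LargeEvenFree N = ∀ e → Even e → 2 * l ≤ e → e < N → ¬ Term e

  small-even-term : ∀ {N e} → LargeEvenFree N → Even e → Term e → e < N → e ≤ 2 * l ∸ 2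
  small-even-term {N} {e} free ee te e<N with 2 * l ≤? e
  ... | yes 2l≤e = ⊥-elim (free e ee 2l≤e e<N te)
  ... | no 2l≰e = m+n≤o⇒m≤o∸n e (even<even⇒+2≤ ee (divides l (*-comm 2 l)) (≰⇒> 2l≰e))

  PeriodicBelow : ℕ → ℕ → Set
  PeriodicBelow N m = Odd m → p ≤ m → m + d < N → Term m ⇔ Term (m + d)

  -- On [p, p + 2l - 2) this is the window hypothesis.
  window-period : ∀ {N} m → m < p + (2 * l ∸ 2) → PeriodicBelow N m
  window-period m m<K odd-m p≤m _ with m≤n⇒∃[o]m+o≡n p≤m
  ... | k , refl with odd-difference odd-p odd-m
  ... | divides i refl = mk⇔ (subst T same) (subst T (sym same))
    where
    i<l-1 : i < l ∸ 1
    i<l-1 = *-cancelʳ-< 2 i (l ∸ 1) (subst (i * 2 <_) (double-pred l) (+-cancelˡ-< p (i * 2) _ m<K))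
    same : indU a b (p + i * 2) ≡ indU a b (p + i * 2 + d)
    same = begin
      indU a b (p + i * 2)     ≡⟨ cong (λ x → indU a b (p + x)) (*-comm i 2) ⟩
      indU a b (p + 2 * i)     ≡⟨ window i i<l-1 ⟩
      indU a b (p + d + 2 * i) ≡⟨ cong (indU a b) (rearrange p d i) ⟩
      indU a b (p + i * 2 + d) ∎
      where
      open ≡-Reasoning
      rearrange : ∀ p d i → p + d + 2 * i ≡ p + i * 2 + d
      rearrange = solve-∀

  -- Beyond the window, the ulam rule transfers periodicity from smaller odd
  -- numbers: the even summands of m and of m + d are the same small terms.
  beyond-window : ∀ {N m} → LargeEvenFree N → (∀ {m'} → m' < m → PeriodicBelow N m') →
                  p + (2 * l ∸ 2) ≤ m → PeriodicBelow N m
  beyond-window {N} {m} free ih K≤m odd-m p≤m m+d<N = begin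
    Term m                          ≈⟨ ulam-rule b<m ⟩
    UniqueRep m                     ≈⟨ odd-rule odd-m ⟩
    ∃! _≡_ (EvenSummand m)          ≈⟨ ∃!-cong shift-summand ⟩
    ∃! _≡_ (EvenSummand (m + d))    ≈⟨ odd-rule (odd+even odd-m even-d) ⟨
    UniqueRep (m + d)               ≈⟨ ulam-rule (<-≤-trans b<m (m≤m+n m d)) ⟨
    Term (m + d)                    ∎
    where
    open ⇔-Reasoning
    bound≤m : 2 * l ∸ 2 ≤ m
    bound≤m = ≤-trans (m≤n+m _ p) K≤m

    b<m : b < m
    b<m = <-≤-trans b<2l-2 bound≤m

    small-summand : ∀ {e} → Even e → Term e → e ≤ m + d → e ≤ 2 * l ∸ 2
    small-summand ee te e≤m+d = small-even-term free ee te (≤-<-trans e≤m+d m+d<N)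

    -- Their complements in m are odd numbers in the range of the induction hypothesis.
    complement-periodic : ∀ {e o} → Even e → Term e → e + o ≡ m → Term o ⇔ Term (o + d)
    complement-periodic {e} {o} ee te refl =
      ih (m<n+m o (term-pos te)) (complement-odd odd-m ee refl) p≤o
         (≤-<-trans (+-monoˡ-≤ d (m≤n+m o e)) m+d<N)
      where
      p≤o : p ≤ o
      p≤o = +-cancelʳ-≤ e p o (subst (p + e ≤_) (+-comm e o)
              (≤-trans (+-monoʳ-≤ p (small-summand ee te (≤-trans (m≤m+n e o) (m≤m+n m d)))) K≤m))

    shift-summand : ∀ e → EvenSummand m e ⇔ EvenSummand (m + d) e
    shift-summand e = mk⇔ forward backward
      where
      forward : EvenSummand m e → EvenSummand (m + d) e
      forward (ee , te , o , t-o , sum) =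
        ee , te , o + d , to (complement-periodic ee te sum) t-o ,
        trans (sym (+-assoc e o d)) (cong (_+ d) sum)
      backward : EvenSummand (m + d) e → EvenSummand m e
      backward (ee , te , o' , t-o' , sum)
        with o , e+o≡m ← m≤n⇒∃[o]m+o≡n (≤-trans (small-summand ee te (subst (e ≤_) sum (m≤m+n e o'))) bound≤m)
        = ee , te , o , from (complement-periodic ee te e+o≡m) (subst Term o'≡o+d t-o') , e+o≡m
        where
        o'≡o+d : o' ≡ o + d
        o'≡o+d = +-cancelˡ-≡ e o' (o + d) (trans sum (trans (cong (_+ d) (sym e+o≡m)) (+-assoc e o d)))

  periodic : ∀ {N} → LargeEvenFree N → ∀ m → PeriodicBelow N m
  periodic {N} free = <-rec (PeriodicBelow N) step
    where
    step : ∀ m → (∀ {m'} → m' < m → PeriodicBelow N m') → PeriodicBelow N m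
    step m ih with m <? p + (2 * l ∸ 2)
    ... | yes m<K = window-period m m<K
    ... | no m≮K = beyond-window free ih (≮⇒≥ m≮K)

  q : ℕ
  q = p + d

  2l≤⇒b< : ∀ {n} → 2 * l ≤ n → b < n
  2l≤⇒b< 2l≤n = <-≤-trans b<2l-2 (≤-trans (m∸n≤m _ 2) 2l≤n)

  -- Above 2q + d, a number with a unique representation has it with two odd
  -- parts, and the periodicity lets us move d between the two parts.
  module AboveThreshold {n} (2l≤q : 2 * l ≤ q) (free : LargeEvenFree n) (even-n : Even n)
                        (2q+d<n : q + q + d < n) where

    shift : ∀ {x} → Odd x → p ≤ x → x + d < n → Term x ⇔ Term (x + d)
    shift {x} = periodic free x

    large-rep : ∀ {k u v} → k ≤ n → Even k → q + q ≤ k → IsRep k (u , v) → Odd u × Odd v × q < v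
    large-rep {k} {u} {v} k≤n even-k 2q≤k rep@(_ , t-v , u<v , sum) = odd-u , odd-v , q<v
      where
      q<v : q < v
      q<v = top-above-half u<v sum 2q≤k
      odd-v : Odd v
      odd-v even-v = free v even-v (≤-trans 2l≤q (<⇒≤ q<v)) (<-≤-trans (proj₂ (rep-parts< rep)) k≤n) t-v
      odd-u : Odd u
      odd-u even-u = odd-v (∣m+n∣m⇒∣n (subst Even (sym sum) even-k) even-u)

    2q≤n : q + q ≤ n
    2q≤n = ≤-trans (m≤m+n _ d) (<⇒≤ 2q+d<n)

    2l≤n : 2 * l ≤ n
    2l≤n = ≤-trans 2l≤q (≤-trans (m≤m+n q q) 2q≤n)

    above-q⇒d≤ : ∀ {x} → q < x → d ≤ x
    above-q⇒d≤ q<x = ≤-trans (m≤n+m d p) (<⇒≤ q<x)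

    -- If the larger part exceeds the smaller by more than d, shifting it down
    -- by d gives the unique representation of n - d, an even term below n.
    far-pair : ∀ {u v} → IsRep n (u , v) → (∀ {uv} → IsRep n uv → (u , v) ≡ uv) → u + d < v → ⊥
    far-pair {u} {v} rep@(t-u , t-v , u<v , sum) only u+d<v
      with _ , odd-v , q<v ← large-rep ≤-refl even-n 2q≤n rep
      with w , refl ← below-by (above-q⇒d≤ q<v)
      = free k even-k 2l≤k k<n (from (ulam-rule (2l≤⇒b< 2l≤k)) unique-k)
      where
      k : ℕ
      k = u + w
      k+d≡n : k + d ≡ n
      k+d≡n = trans (+-assoc u w d) sum
      2q≤k : q + q ≤ k
      2q≤k = <⇒≤ (+-cancelʳ-< d (q + q) k (subst (q + q + d <_) (sym k+d≡n) 2q+d<n))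
      k<n : k < n
      k<n = subst (k <_) k+d≡n (m<m+n k 0<d)
      2l≤k : 2 * l ≤ k
      2l≤k = ≤-trans 2l≤q (≤-trans (m≤m+n q q) 2q≤k)
      even-k : Even k
      even-k = ∣m+n∣m⇒∣n (subst Even (trans (sym k+d≡n) (+-comm k d)) even-n) even-d
      t-w : Term w
      t-w = from (shift (λ even-w → odd-v (even+even even-w even-d))
                        (<⇒≤ (+-cancelʳ-< d p w q<v)) (proj₂ (rep-parts< rep)))
                 t-v
      -- Any representation u' + v' of k lifts to the representation u' + (v' + d) of n.
      only-k : ∀ {uv'} → IsRep k uv' → (u , w) ≡ uv'
      only-k {u' , v'} rep'@(t-u' , t-v' , u'<v' , sum')
        with _ , odd-v' , q<v' ← large-rep (<⇒≤ k<n) even-k 2q≤k rep'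
        = same-sum-first (sym sum') (cong proj₁ (only lifted))
        where
        v'+d<n : v' + d < n
        v'+d<n = subst (v' + d <_) k+d≡n (+-monoˡ-< d (proj₂ (rep-parts< rep')))
        lifted : IsRep n (u' , v' + d)
        lifted = t-u' , to (shift odd-v' (≤-trans (m≤m+n p d) (<⇒≤ q<v')) v'+d<n) t-v' ,
                 <-≤-trans u'<v' (m≤m+n v' d) ,
                 trans (sym (+-assoc u' v' d)) (trans (cong (_+ d) sum') k+d≡n)
      unique-k : UniqueRep k
      unique-k = (u , w) , (t-u , t-w , +-cancelʳ-< d u w u+d<v , refl) , only-k

    -- If the smaller part u of the unique representation has v ≤ u + d, it lies above q ...
    smaller-above-q : ∀ {u v} → IsRep n (u , v) → v ≤ u + d → q < u
    smaller-above-q {u} {v} (_ , _ , _ , sum) v≤u+d with q <? u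
    ... | yes q<u = q<u
    ... | no q≮u = contradiction (subst (_≤ q + q + d) sum u+v≤2q+d) (<⇒≱ 2q+d<n)
      where
      u≤q : u ≤ q
      u≤q = ≮⇒≥ q≮u
      u+v≤2q+d : u + v ≤ q + q + d
      u+v≤2q+d = ≤-trans (+-mono-≤ u≤q (≤-trans v≤u+d (+-monoˡ-≤ d u≤q))) (≤-reflexive (sym (+-assoc q q d)))

    -- ... and moving d from it to the larger part gives a second representation of n.
    near-pair : ∀ {u v} → IsRep n (u , v) → (∀ {uv} → IsRep n uv → (u , v) ≡ uv) → q < u → ⊥
    near-pair {u} {v} rep@(t-u , t-v , u<v , sum) only q<u
      with w , refl ← below-by (above-q⇒d≤ q<u)
      with odd-w+d , odd-v , q<v ← large-rep ≤-refl even-n 2q≤n rep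
      = <-irrefl (sym (cong proj₁ (only second))) (m<m+n w 0<d)
      where
      p≤w : p ≤ w
      p≤w = <⇒≤ (+-cancelʳ-< d p w q<u)
      t-w : Term w
      t-w = from (shift (λ even-w → odd-w+d (even+even even-w even-d)) p≤w (proj₁ (rep-parts< rep))) t-u
      v+d<n : v + d < n
      v+d<n = subst (v + d <_) (trans (+-comm v (w + d)) sum)
                    (+-monoʳ-< v (m<n+m d (<-≤-trans (odd⇒0< odd-p) p≤w)))
      t-v+d : Term (v + d)
      t-v+d = to (shift odd-v (≤-trans (m≤m+n p d) (<⇒≤ q<v)) v+d<n) t-v
      second : IsRep n (w , v + d)
      second = t-w , t-v+d , <-trans (m<m+n w 0<d) (<-≤-trans u<v (m≤m+n v d)) ,
               trans (cong (w +_) (+-comm v d)) (trans (sym (+-assoc w d v)) sum)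

    not-term : ¬ Term n
    not-term t-n with (u , v) , rep , only ← to (ulam-rule (2l≤⇒b< 2l≤n)) t-n
      with u + d <? v
    ... | yes u+d<v = far-pair rep only u+d<v
    ... | no u+d≮v = near-pair rep only (smaller-above-q rep (≮⇒≥ u+d≮v))

  no-large-even-term : 2 * l ≤ q → LargeEvenFree (suc (q + q + d)) → ∀ n → Even n → 2 * l ≤ n → ¬ Term n
  no-large-even-term 2l≤q free-initially = <-rec _ step
    where
    step : ∀ n → (∀ {k} → k < n → Even k → 2 * l ≤ k → ¬ Term k) → Even n → 2 * l ≤ n → ¬ Term n
    step n ih even-n 2l≤n with n ≤? q + q + d
    ... | yes n≤2q+d = free-initially n even-n 2l≤n (s≤s n≤2q+d)
    ... | no n≰2q+d = AboveThreshold.not-term 2l≤q (λ k even-k 2l≤k k<n → ih k<n even-k 2l≤k) even-n (≰⇒> n≰2q+d)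


theorem4p1 : (l a b p q : ℕ) → 0 < l → 0 < a →
    ¬ (2 ∣ p) → ¬ (2 ∣ q) → p < q →
    2 * l ≤ q → a < b → b < 2 * l ∸ 2 →
    S l a b p ≡ S l a b q →
    ((n : ℕ) → 2 ∣ n → 2 * l ≤ n → n ≤ 3 * q ∸ p → indU a b n ≡ false) →
    (n : ℕ) → 2 ∣ n → 2 * l ≤ n → indU a b n ≡ false
theorem4p1 l a b p q _ 0<a odd-p odd-q p<q 2l≤q a<b b<2l-2 same-S small-free n even-n 2l≤n
  with d , refl ← m≤n⇒∃[o]m+o≡n (<⇒≤ p<q)
  = ¬-not (not-term ∘ from T-≡)
  where
  window : ∀ i → i < l ∸ 1 → indU a b (p + 2 * i) ≡ indU a b (p + d + 2 * i)
  window i i<l-1 = map-≡⇒pointwise same-S (∈-upTo⁺ i<l-1)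
  open Setting a b l p d 0<a a<b b<2l-2 odd-p odd-q (subst (0 <_) (m+n∸m≡n p d) (m<n⇒0<n∸m p<q)) window
    using (LargeEvenFree; no-large-even-term)
  free-initially : LargeEvenFree (suc ((p + d) + (p + d) + d))
  free-initially e even-e 2l≤e (s≤s e≤2q+d) =
    subst T (small-free e even-e 2l≤e (subst (e ≤_) (sym (three-q∸p p d)) e≤2q+d))
  not-term : ¬ T (indU a b n)
  not-term = no-large-even-term 2l≤q free-initially n even-n 2l≤n
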